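{- Let $\Sigma$ be a finite alphabet with $\sigma=|\Sigma|$ and $w\in\Sigma^*$. Then $w$ has at most $2\sigma!$ prefixes $p$ such that $p$ is a parameterized square and no fragment of $w$ starting at a position other than $1$ is equivalent to $p$ in the parameterized sense.
   Context: Two words $u,v$ are equivalent in the parameterized sense if $|u|=|v|$ and there is a bijection $f:\mathrm{Alph}(u)\to\mathrm{Alph}(v)$ ($\mathrm{Alph}$ = set of letters occurring) with $v[t]=f(u[t])$ for all $t$. A parameterized square is a word $uv$ with $u,v$ nonempty and $u,v$ equivalent in the parameterized sense. -}

module Defs where

open import Data.Nat using (ℕ; _≤_; _+_; suc)
open import Data.Fin using (Fin)
open import Data.List using (List; []; _++_; take; drop; length; map)
open import Data.List.Membership.Propositional using (_∈_)
open import Data.Product using (Σ; _×_; ∃; ∃-syntax)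
open import Relation.Binary.PropositionalEquality using (_≡_)
open import Relation.Nullary using (¬_)

Word : ℕ → Set
Word σ = List (Fin σ)

-- Alph(u) = letters occurring in u (membership a ∈ u).
-- u and v are equivalent in the parameterized sense: there is a map f
-- with v[t] = f(u[t]) for all t (i.e. v ≡ map f u, which forces |u| = |v|
-- and makes f restricted to Alph(u) onto Alph(v)), and f is injective on
-- Alph(u); hence f : Alph(u) → Alph(v) is a bijection.
PEquiv : ∀ {σ} → Word σ → Word σ → Set
PEquiv {σ} u v =
  ∃[ f ] (v ≡ map f u) ×
         (∀ {a b : Fin σ} → a ∈ u → b ∈ u → f a ≡ f b → a ≡ b)

PSquare : ∀ {σ} → Word σ → Set
PSquare x = ∃[ u ] ∃[ v ] (¬ u ≡ []) × (¬ v ≡ []) × (x ≡ u ++ v) × PEquiv u v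

-- The prefix of w of length k (with k ≤ |w|) is a parameterized square and
-- no fragment of w starting at a position other than the first one
-- (0-indexed start i ≥ 1) is p-equivalent to it.
GoodPrefixLength : ∀ {σ} → Word σ → ℕ → Set
GoodPrefixLength w k =
  k ≤ length w × PSquare (take k w) ×
  (∀ i → 1 ≤ i → i + k ≤ length w → ¬ PEquiv (take k (drop i w)) (take k w))

-- Every good prefix of length 2m comes with a permutation π of Σ, extending the bijection
-- between its halves, such that w[m + t] = π(w[t]) for t < m.  No three good prefixes share
-- a permutation.  For half-lengths m < m + d < m + d + e: if d + e < m, the three squares
-- force a period p ≤ min(d, e) on w[0, 2(m + d)), so the shortest prefix reappears at
-- position p; otherwise 2m ≤ m + d + e, and the shortest prefix reappears, relabelled by
-- π⁻¹, inside the second half of the longest square.  Either way it is not good.  Hence each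
-- of the σ! permutations serves at most two good prefixes.

module Submission where

open import Defs
open import Data.Empty using (⊥; ⊥-elim)
open import Data.Fin using (Fin; zero; suc; punchOut; punchIn)
open import Data.Fin.Permutation using (Permutation′; _⟨$⟩ʳ_; _⟨$⟩ˡ_; _∘ₚ_; transpose; inverseˡ; flip)
import Data.Fin.Permutation as Permutation
import Data.Fin.Permutation.Components as Components
open import Data.Fin.Properties using (_≟_; 0≢1+n; suc-injective; punchOut-injective; punchIn-punchOut)
open import Data.List using (List; []; _∷_; _++_; take; drop; length; map; filter; allFin)
open import Data.List.Properties using (length-++; length-map; length-take; length-tabulate; take-map; map-cong-local)
open import Data.List.Membership.Propositional using (_∈_)
open import Data.List.Membership.Propositional.Properties using (∈-allFin; ∈-map∘filter⁻)
open import Data.List.Relation.Binary.Sublist.Propositional.Properties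
  using (filter-⊆; length-mono-≤) renaming (filter⁺ to Sublist-filter⁺)
open import Data.List.Relation.Unary.All as All using (All; []; _∷_)
open import Data.List.Relation.Unary.All.Properties using (all-filter) renaming (filter⁺ to All-filter⁺)
open import Data.List.Relation.Unary.AllPairs using (AllPairs; []; _∷_)
import Data.List.Relation.Unary.AllPairs.Properties as AllPairs
open import Data.List.Relation.Unary.Any as Any using (here; there)
open import Data.List.Relation.Unary.Unique.Propositional using (Unique)
open import Data.Maybe using (Maybe; just; nothing)
import Data.Maybe as Maybe
open import Data.Maybe.Properties using (just-injective)
import Data.Maybe.Properties as Maybeₚ
open import Data.Nat using (ℕ; zero; suc; _+_; _*_; _⊓_; _≤_; _<_; z≤n; s≤s; _<?_; _≤?_; _!)
open import Data.Nat.Induction using (<-wellFounded)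
open import Data.Nat.Properties
  using ( ≤-refl; ≤-reflexive; ≤-trans; <-≤-trans; ≤-<-trans; <⇒≤; ≮⇒≥; ≰⇒>; <⇒≱; <-cmp
        ; +-assoc; +-comm; +-suc; *-assoc; *-comm; m≤m+n; m≤n+m; m≤n⇒∃[o]m+o≡n; m≤n⇒m⊓n≡m
        ; +-mono-≤; +-monoˡ-≤; +-monoʳ-≤; +-monoˡ-<; +-monoʳ-<; +-cancelʳ-≤; +-cancelˡ-<
        ; module ≤-Reasoning )
open import Data.Nat.Tactic.RingSolver using (solve-∀)
open import Data.Product using (Σ; Σ-syntax; ∃-syntax; _×_; _,_; proj₁; proj₂; map₂)
open import Function using (_∘_; _on_; id)
open import Function.Definitions using (Injective)
open import Induction.WellFounded using (Acc; acc)
open import Relation.Binary.Definitions using (DecidableEquality; tri<; tri≈; tri>)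
open import Relation.Binary.PropositionalEquality
open import Relation.Nullary using (¬_; yes; no; contradiction)
open import Relation.Unary using (Decidable)
open import Relation.Unary.Properties using (∁?)

length-filter+∁ : ∀ {A : Set} {P : A → Set} (P? : Decidable P) (xs : List A) →
                  length xs ≡ length (filter P? xs) + length (filter (∁? P?) xs)
length-filter+∁ P? [] = refl
length-filter+∁ P? (x ∷ xs) with P? x
... | yes _ = cong suc (length-filter+∁ P? xs)
... | no _ = trans (cong suc (length-filter+∁ P? xs)) (sym (+-suc _ _))

module _ {A B : Set} (_≟_ : DecidableEquality B) (class : A → B) where

  InClass? : (b : B) → Decidable (λ x → class x ≡ b)
  InClass? b x = class x ≟ b

  pigeonhole : ∀ N (bs : List B) (xs : List A) → All (λ x → class x ∈ bs) xs →
               (∀ b → length (filter (InClass? b) xs) ≤ N) → length xs ≤ length bs * N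
  pigeonhole N [] [] _ _ = z≤n
  pigeonhole N [] (_ ∷ _) (() ∷ _) _
  pigeonhole N (b ∷ bs) xs covered bounded = begin
    length xs                                        ≡⟨ length-filter+∁ (InClass? b) xs ⟩
    length (filter (InClass? b) xs) + length others  ≤⟨ +-mono-≤ (bounded b) others-bound ⟩
    N + length bs * N                                ∎
    where
    open ≤-Reasoning
    others : List A
    others = filter (∁? (InClass? b)) xs
    others-covered : All (λ x → class x ∈ bs) others
    others-covered = All.zipWith (λ (c≢b , c∈) → Any.tail c≢b c∈)
                       (all-filter (∁? (InClass? b)) xs , All-filter⁺ (∁? (InClass? b)) covered)
    others-bounded : ∀ b′ → length (filter (InClass? b′) others) ≤ N
    others-bounded b′ = ≤-trans
      (length-mono-≤ (Sublist-filter⁺ (InClass? b′) (InClass? b′) (λ { refl p → p }) (filter-⊆ _ xs)))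
      (bounded b′)
    others-bound : length others ≤ length bs * N
    others-bound = pigeonhole N bs others others-covered others-bounded

InjectiveMap : ℕ → Set
InjectiveMap n = Σ (Fin n → Fin n) (Injective _≡_ _≡_)

removeHead : ∀ {n} → InjectiveMap (suc n) → InjectiveMap n
removeHead (f , f-inj) = g , g-inj
  where
  head≢ : ∀ i → f zero ≢ f (suc i)
  head≢ i = 0≢1+n ∘ f-inj
  g : Fin _ → Fin _
  g i = punchOut (head≢ i)
  g-inj : Injective _≡_ _≡_ g
  g-inj eq = suc-injective (f-inj (punchOut-injective (head≢ _) (head≢ _) eq))

≗-removeHead⇒≗ : ∀ {n} (f g : InjectiveMap (suc n)) → proj₁ f zero ≡ proj₁ g zero →
                  proj₁ (removeHead f) ≗ proj₁ (removeHead g) → proj₁ f ≗ proj₁ g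
≗-removeHead⇒≗ f g head-eq tail-eq zero = head-eq
≗-removeHead⇒≗ f g head-eq tail-eq (suc i) = begin
  proj₁ f (suc i)                                     ≡⟨ punchIn-punchOut _ ⟨
  punchIn (proj₁ f zero) (proj₁ (removeHead f) i)     ≡⟨ cong₂ punchIn head-eq (tail-eq i) ⟩
  punchIn (proj₁ g zero) (proj₁ (removeHead g) i)     ≡⟨ punchIn-punchOut _ ⟩
  proj₁ g (suc i)                                     ∎
  where open ≡-Reasoning

module _ {K : Set} where

  itemMap : ∀ {n} → K × InjectiveMap n → Fin n → Fin n
  itemMap = proj₁ ∘ proj₂

  DistinctKeys : ∀ {n} → List (K × InjectiveMap n) → Set
  DistinctKeys = AllPairs (_≢_ on proj₁)

  NoThreeShareAMap : ∀ {n} → List (K × InjectiveMap n) → Set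
  NoThreeShareAMap ps = ∀ {x y z} → x ∈ ps → y ∈ ps → z ∈ ps →
    proj₁ x ≢ proj₁ y → proj₁ y ≢ proj₁ z → proj₁ x ≢ proj₁ z →
    itemMap x ≗ itemMap y → itemMap y ≗ itemMap z → ⊥

  headValue : ∀ {n} → K × InjectiveMap (suc n) → Fin (suc n)
  headValue x = itemMap x zero

  withHead : ∀ {n} → Fin (suc n) → List (K × InjectiveMap (suc n)) → List (K × InjectiveMap n)
  withHead b ps = map (map₂ removeHead) (filter (InClass? _≟_ headValue b) ps)

  ∈-withHead⁻ : ∀ {n} b (ps : List (K × InjectiveMap (suc n))) {y} → y ∈ withHead b ps →
                ∃[ x ] x ∈ ps × y ≡ map₂ removeHead x × headValue x ≡ b
  ∈-withHead⁻ b ps = ∈-map∘filter⁻ (map₂ removeHead) (InClass? _≟_ headValue b) {xs = ps}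

  NoThreeShareAMap-withHead : ∀ {n} b (ps : List (K × InjectiveMap (suc n))) →
                              NoThreeShareAMap ps → NoThreeShareAMap (withHead b ps)
  NoThreeShareAMap-withHead b ps noThree x∈ y∈ z∈ x≢y y≢z x≢z x≗y y≗z
    with x , x∈ps , refl , x↦b ← ∈-withHead⁻ b ps x∈
       | y , y∈ps , refl , y↦b ← ∈-withHead⁻ b ps y∈
       | z , z∈ps , refl , z↦b ← ∈-withHead⁻ b ps z∈ =
    noThree x∈ps y∈ps z∈ps x≢y y≢z x≢z
      (≗-removeHead⇒≗ (proj₂ x) (proj₂ y) (trans x↦b (sym y↦b)) x≗y)
      (≗-removeHead⇒≗ (proj₂ y) (proj₂ z) (trans y↦b (sym z↦b)) y≗z)

  length≤2*n! : ∀ n (ps : List (K × InjectiveMap n)) → DistinctKeys ps → NoThreeShareAMap ps →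
                length ps ≤ 2 * n !
  length≤2*n! zero [] _ _ = z≤n
  length≤2*n! zero (_ ∷ []) _ _ = s≤s z≤n
  length≤2*n! zero (_ ∷ _ ∷ []) _ _ = s≤s (s≤s z≤n)
  length≤2*n! zero (_ ∷ _ ∷ _ ∷ _) ((x≢y ∷ x≢z ∷ _) ∷ (y≢z ∷ _) ∷ _) noThree =
    ⊥-elim (noThree (here refl) (there (here refl)) (there (there (here refl)))
                    x≢y y≢z x≢z (λ ()) (λ ()))
  length≤2*n! (suc n) ps distinct noThree = begin
    length ps                            ≤⟨ pigeonhole _≟_ headValue (2 * n !) (allFin (suc n)) ps
                                              (All.tabulate (λ {x} _ → ∈-allFin (headValue x))) class-bounded ⟩
    length (allFin (suc n)) * (2 * n !)  ≡⟨ cong (_* (2 * n !)) (length-tabulate {n = suc n} id) ⟩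
    suc n * (2 * n !)                    ≡⟨ *-assoc (suc n) 2 (n !) ⟨
    suc n * 2 * n !                      ≡⟨ cong (_* n !) (*-comm (suc n) 2) ⟩
    2 * suc n * n !                      ≡⟨ *-assoc 2 (suc n) (n !) ⟩
    2 * (suc n) !                        ∎
    where
    open ≤-Reasoning
    class-bounded : ∀ b → length (filter (InClass? _≟_ headValue b) ps) ≤ 2 * n !
    class-bounded b = subst (_≤ 2 * n !) (length-map _ (filter (InClass? _≟_ headValue b) ps))
      (length≤2*n! n (withHead b ps) (AllPairs.map⁺ (AllPairs.filter⁺ _ distinct))
                   (NoThreeShareAMap-withHead b ps noThree))

module _ {B : Set} (x : ℕ → B) where

  HasPeriod : ℕ → ℕ → Set
  HasPeriod p L = ∀ i → i + p < L → x i ≡ x (i + p)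

  SquareUnder : (B → B) → ℕ → Set
  SquareUnder F m = ∀ t → t < m → x (m + t) ≡ F (x t)

  HasPeriod-≤ : ∀ {p L L′} → L′ ≤ L → HasPeriod p L → HasPeriod p L′
  HasPeriod-≤ L′≤L per i i+p<L′ = per i (<-≤-trans i+p<L′ L′≤L)

  squares⇒period : ∀ {F m d} → Injective _≡_ _≡_ F →
                   SquareUnder F m → SquareUnder F (m + d) → HasPeriod d m
  squares⇒period {F} {m} {d} F-inj sq sq′ i i+d<m = F-inj (begin
    F (x i)          ≡⟨ sq′ i i<m+d ⟨
    x (m + d + i)    ≡⟨ cong x (trans (+-assoc m d i) (cong (m +_) (+-comm d i))) ⟩
    x (m + (i + d))  ≡⟨ sq (i + d) i+d<m ⟩
    F (x (i + d))    ∎)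
    where
    open ≡-Reasoning
    i<m+d : i < m + d
    i<m+d = <-≤-trans (≤-<-trans (m≤m+n i d) i+d<m) (m≤m+n m d)

  period-extend : ∀ {p e a b} → 1 ≤ e → e + p ≤ a →
                  HasPeriod p a → HasPeriod e b → HasPeriod p b
  period-extend {p} {e} {a} {b} 1≤e e+p≤a per-p per-e i = go i (<-wellFounded i)
    where
    go : ∀ i → Acc _<_ i → i + p < b → x i ≡ x (i + p)
    go i (acc rec) i+p<b with i + p <? a
    ... | yes i+p<a = per-p i i+p<a
    ... | no i+p≮a with m≤n⇒∃[o]m+o≡n (+-cancelʳ-≤ p e i (≤-trans e+p≤a (≮⇒≥ i+p≮a)))
    ... | j , refl = begin
      x (e + j)          ≡⟨ cong x (+-comm e j) ⟩
      x (j + e)          ≡⟨ per-e j (subst (_< b) (+-comm e j) (≤-<-trans (m≤m+n (e + j) p) i+p<b)) ⟨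
      x j                ≡⟨ go j (rec j<e+j) (≤-<-trans (+-monoˡ-≤ p (m≤n+m j e)) i+p<b) ⟩
      x (j + p)          ≡⟨ per-e (j + p) (subst (_< b) e+j+p≡j+p+e i+p<b) ⟩
      x (j + p + e)      ≡⟨ cong x e+j+p≡j+p+e ⟨
      x (e + j + p)      ∎
      where
      open ≡-Reasoning
      j<e+j : j < e + j
      j<e+j = +-monoˡ-≤ j 1≤e
      e+j+p≡j+p+e : e + j + p ≡ j + p + e
      e+j+p≡j+p+e = trans (+-assoc e j p) (+-comm e (j + p))

  square-doubles-period : ∀ {F p m L} → SquareUnder F m → m + p ≤ L →
                          HasPeriod p m → HasPeriod p L → HasPeriod p (m + m)
  square-doubles-period {F} {p} {m} {L} sq m+p≤L per-m per-L i i+p<m+m with i + p <? L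
  ... | yes i+p<L = per-L i i+p<L
  ... | no i+p≮L with m≤n⇒∃[o]m+o≡n (+-cancelʳ-≤ p m i (≤-trans m+p≤L (≮⇒≥ i+p≮L)))
  ... | j , refl = begin
    x (m + j)         ≡⟨ sq j (≤-<-trans (m≤m+n j p) j+p<m) ⟩
    F (x j)           ≡⟨ cong F (per-m j j+p<m) ⟩
    F (x (j + p))     ≡⟨ sq (j + p) j+p<m ⟨
    x (m + (j + p))   ≡⟨ cong x (+-assoc m j p) ⟨
    x (m + j + p)     ∎
    where
    open ≡-Reasoning
    j+p<m : j + p < m
    j+p<m = +-cancelˡ-< m (j + p) m (subst (_< m + m) (+-assoc m j p) i+p<m+m)

  short-period : ∀ {F m d e} → Injective _≡_ _≡_ F → 1 ≤ d → 1 ≤ e → d + e < m →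
                 SquareUnder F m → SquareUnder F (m + d) → SquareUnder F (m + d + e) →
                 ∃[ p ] 1 ≤ p × p ≤ d × p ≤ e × HasPeriod p (m + d)
  short-period {F} {m} {d} {e} F-inj 1≤d 1≤e d+e<m sq₀ sq₁ sq₂ with d ≤? e
  ... | yes d≤e = d , 1≤d , ≤-refl , d≤e ,
        period-extend 1≤e (≤-trans (≤-reflexive (+-comm e d)) (<⇒≤ d+e<m))
          (squares⇒period F-inj sq₀ sq₁) (squares⇒period F-inj sq₁ sq₂)
  ... | no d≰e = e , 1≤e , <⇒≤ (≰⇒> d≰e) , ≤-refl , squares⇒period F-inj sq₁ sq₂

  three-squares⇒period : ∀ {F m d e} → Injective _≡_ _≡_ F → 1 ≤ d → 1 ≤ e → d + e < m →
                         SquareUnder F m → SquareUnder F (m + d) → SquareUnder F (m + d + e) →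
                         ∃[ p ] 1 ≤ p × p ≤ d × HasPeriod p ((m + d) + (m + d))
  three-squares⇒period {F} {m} {d} {e} F-inj 1≤d 1≤e d+e<m sq₀ sq₁ sq₂
    with short-period F-inj 1≤d 1≤e d+e<m sq₀ sq₁ sq₂
  ... | p , 1≤p , p≤d , p≤e , per = p , 1≤p , p≤d ,
    square-doubles-period {F} sq₁ m+d+p≤m+m per
      (square-doubles-period {F} sq₀ (+-monoʳ-≤ m p≤d) (HasPeriod-≤ (m≤m+n m d) per) per)
    where
    m+d+p≤m+m : m + d + p ≤ m + m
    m+d+p≤m+m = begin
      m + d + p   ≡⟨ +-assoc m d p ⟩
      m + (d + p) ≤⟨ +-monoʳ-≤ m (+-monoʳ-≤ d p≤e) ⟩
      m + (d + e) ≤⟨ +-monoʳ-≤ m (<⇒≤ d+e<m) ⟩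
      m + m       ∎
      where open ≤-Reasoning

-- Positions past the end read as nothing, so w ‼_ is a sequence ℕ → Maybe (Fin σ) to which
-- the period lemmas apply.
infixl 9 _‼_

_‼_ : ∀ {A : Set} → List A → ℕ → Maybe A
[]       ‼ _     = nothing
(x ∷ xs) ‼ zero  = just x
(x ∷ xs) ‼ suc t = xs ‼ t

module _ {A : Set} where

  take-‼ : ∀ k (xs : List A) {t} → t < k → take k xs ‼ t ≡ xs ‼ t
  take-‼ (suc k) []       _       = refl
  take-‼ (suc k) (x ∷ xs) {zero}  _         = refl
  take-‼ (suc k) (x ∷ xs) {suc t} (s≤s t<k) = take-‼ k xs t<k

  take-cong-‼ : ∀ k (xs ys : List A) → (∀ t → t < k → xs ‼ t ≡ ys ‼ t) → take k xs ≡ take k ys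
  take-cong-‼ zero    xs       ys       _  = refl
  take-cong-‼ (suc k) []       []       _  = refl
  take-cong-‼ (suc k) []       (y ∷ ys) eq with () ← eq 0 (s≤s z≤n)
  take-cong-‼ (suc k) (x ∷ xs) []       eq with () ← eq 0 (s≤s z≤n)
  take-cong-‼ (suc k) (x ∷ xs) (y ∷ ys) eq =
    cong₂ _∷_ (just-injective (eq 0 (s≤s z≤n))) (take-cong-‼ k xs ys (λ t → eq (suc t) ∘ s≤s))

  drop-‼ : ∀ i (xs : List A) t → drop i xs ‼ t ≡ xs ‼ (i + t)
  drop-‼ zero    xs       t = refl
  drop-‼ (suc i) []       t = refl
  drop-‼ (suc i) (x ∷ xs) t = drop-‼ i xs t

  map-‼ : ∀ {B : Set} (f : A → B) (xs : List A) t → map f xs ‼ t ≡ Maybe.map f (xs ‼ t)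
  map-‼ f []       t       = refl
  map-‼ f (x ∷ xs) zero    = refl
  map-‼ f (x ∷ xs) (suc t) = map-‼ f xs t

  ++-‼ˡ : ∀ (u v : List A) {t} → t < length u → (u ++ v) ‼ t ≡ u ‼ t
  ++-‼ˡ (x ∷ u) v {zero}  _         = refl
  ++-‼ˡ (x ∷ u) v {suc t} (s≤s t<u) = ++-‼ˡ u v t<u

  ++-‼ʳ : ∀ (u v : List A) t → (u ++ v) ‼ (length u + t) ≡ v ‼ t
  ++-‼ʳ []      v t = refl
  ++-‼ʳ (x ∷ u) v t = ++-‼ʳ u v t

module _ {n : ℕ} where

  transpose-first : (i j : Fin n) → Components.transpose i j i ≡ j
  transpose-first i j with i ≟ i
  ... | yes _   = refl
  ... | no i≢i = contradiction refl i≢i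

  transpose-other : (i j k : Fin n) → k ≢ i → k ≢ j → Components.transpose i j k ≡ k
  transpose-other i j k k≢i k≢j with k ≟ i
  ... | yes k≡i = contradiction k≡i k≢i
  ... | no _ with k ≟ j
  ...   | yes k≡j = contradiction k≡j k≢j
  ...   | no _    = refl

  ⟨$⟩ʳ-injective : (π : Permutation′ n) → Injective _≡_ _≡_ (π ⟨$⟩ʳ_)
  ⟨$⟩ʳ-injective π eq = trans (sym (inverseˡ π)) (trans (cong (π ⟨$⟩ˡ_) eq) (inverseˡ π))

  extendToPermutation : (u : List (Fin n)) (f : Fin n → Fin n) →
                        (∀ {a b} → a ∈ u → b ∈ u → f a ≡ f b → a ≡ b) →
                        Σ[ π ∈ Permutation′ n ] (∀ {a} → a ∈ u → π ⟨$⟩ʳ a ≡ f a)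
  extendToPermutation []      f _     = Permutation.id , λ ()
  extendToPermutation (a ∷ u) f f-inj
    with π , π≡f ← extendToPermutation u f (λ a∈ b∈ → f-inj (there a∈) (there b∈)) =
    π ∘ₚ transpose (π ⟨$⟩ʳ a) (f a) , agrees
    where
    τ : Fin n → Fin n
    τ = Components.transpose (π ⟨$⟩ʳ a) (f a)
    agrees : ∀ {b} → b ∈ a ∷ u → τ (π ⟨$⟩ʳ b) ≡ f b
    agrees (here refl) = transpose-first (π ⟨$⟩ʳ a) (f a)
    agrees {b} (there b∈u) with b ≟ a
    ... | yes refl = transpose-first (π ⟨$⟩ʳ a) (f a)
    ... | no b≢a = begin
      τ (π ⟨$⟩ʳ b) ≡⟨ cong τ (π≡f b∈u) ⟩
      τ (f b)       ≡⟨ transpose-other _ _ (f b) fb≢πa fb≢fa ⟩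
      f b           ∎
      where
      open ≡-Reasoning
      fb≢πa : f b ≢ π ⟨$⟩ʳ a
      fb≢πa fb≡πa = b≢a (⟨$⟩ʳ-injective π (trans (π≡f b∈u) fb≡πa))
      fb≢fa : f b ≢ f a
      fb≢fa = b≢a ∘ f-inj (there b∈u) (here refl)

<⇒positive-difference : ∀ {m n} → m < n → ∃[ d ] 1 ≤ d × n ≡ m + d
<⇒positive-difference {m} m<n with o , refl ← m≤n⇒∃[o]m+o≡n m<n = suc o , s≤s z≤n , sym (+-suc m o)

double-<⇒< : ∀ {m n} → m + m < n + n → m < n
double-<⇒< {m} {n} 2m<2n with m <? n
... | yes m<n = m<n
... | no m≮n = contradiction (+-mono-≤ (≮⇒≥ m≮n) (≮⇒≥ m≮n)) (<⇒≱ 2m<2n)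

shift-bound : ∀ {p d} m → p ≤ d → p + (m + m) ≤ (m + d) + (m + d)
shift-bound {p} {d} m p≤d = begin
  p + (m + m)       ≤⟨ +-monoˡ-≤ (m + m) p≤d ⟩
  d + (m + m)       ≤⟨ m≤m+n (d + (m + m)) d ⟩
  d + (m + m) + d   ≡⟨ rearrange d m ⟩
  (m + d) + (m + d) ∎
  where
  open ≤-Reasoning
  rearrange : ∀ d m → d + (m + m) + d ≡ (m + d) + (m + d)
  rearrange = solve-∀

module _ {R : ℕ → Set} (ordered : ∀ {a b c} → a < b → b < c → R a → R b → R c → ⊥) where

  private
    insert : ∀ {a b c} → a < b → c ≢ a → c ≢ b → R a → R b → R c → ⊥
    insert {a} {b} {c} a<b c≢a c≢b ra rb rc with <-cmp c a | <-cmp c b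
    ... | tri< c<a _ _ | _            = ordered c<a a<b rc ra rb
    ... | tri≈ _ c≡a _ | _            = c≢a c≡a
    ... | tri> _ _ a<c | tri< c<b _ _ = ordered a<c c<b ra rc rb
    ... | tri> _ _ _   | tri≈ _ c≡b _ = c≢b c≡b
    ... | tri> _ _ _   | tri> _ _ b<c = ordered a<b b<c ra rb rc

  no-distinct-triple : ∀ {a b c} → a ≢ b → b ≢ c → a ≢ c → R a → R b → R c → ⊥
  no-distinct-triple {a} {b} a≢b b≢c a≢c ra rb rc with <-cmp a b
  ... | tri< a<b _ _ = insert a<b (a≢c ∘ sym) (b≢c ∘ sym) ra rb rc
  ... | tri≈ _ a≡b _ = a≢b a≡b
  ... | tri> _ _ b<a = insert b<a (b≢c ∘ sym) (a≢c ∘ sym) rb ra rc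

module _ {σ : ℕ} (w : Word σ) where

  SquarePrefix : (Fin σ → Fin σ) → ℕ → Set
  SquarePrefix f k = ∃[ m ] k ≡ m + m × SquareUnder (w ‼_) (Maybe.map f) m

  SquarePrefix-≗ : ∀ {f g k} → f ≗ g → SquarePrefix f k → SquarePrefix g k
  SquarePrefix-≗ f≗g (m , k≡m+m , square) =
    m , k≡m+m , λ t t<m → trans (square t t<m) (Maybeₚ.map-cong f≗g (w ‼ t))

  psquare⇒SquarePrefix : ∀ {k} → k ≤ length w → PSquare (take k w) →
                         Σ[ π ∈ Permutation′ σ ] SquarePrefix (π ⟨$⟩ʳ_) k
  psquare⇒SquarePrefix {k} k≤∣w∣ (u , v , _ , _ , w≡u++v , f , v≡fu , f-inj)
    with π , π≡f ← extendToPermutation u f f-inj = π , m , k≡m+m , square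
    where
    m : ℕ
    m = length u
    v≡πu : v ≡ map (π ⟨$⟩ʳ_) u
    v≡πu = trans v≡fu (sym (map-cong-local (All.tabulate π≡f)))
    k≡m+m : k ≡ m + m
    k≡m+m = begin
      k                   ≡⟨ m≤n⇒m⊓n≡m k≤∣w∣ ⟨
      k ⊓ length w        ≡⟨ length-take k w ⟨
      length (take k w)   ≡⟨ cong length w≡u++v ⟩
      length (u ++ v)     ≡⟨ length-++ u ⟩
      m + length v        ≡⟨ cong (λ v → m + length v) v≡πu ⟩
      m + length (map (π ⟨$⟩ʳ_) u) ≡⟨ cong (m +_) (length-map _ u) ⟩
      m + m               ∎
      where open ≡-Reasoning
    prefix-‼ : ∀ {t} → t < m + m → w ‼ t ≡ (u ++ v) ‼ t
    prefix-‼ {t} t<2m = trans (sym (take-‼ k w (subst (t <_) (sym k≡m+m) t<2m))) (cong (_‼ t) w≡u++v)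
    square : SquareUnder (w ‼_) (Maybe.map (π ⟨$⟩ʳ_)) m
    square t t<m = begin
      w ‼ (m + t)                         ≡⟨ prefix-‼ (+-monoʳ-< m t<m) ⟩
      (u ++ v) ‼ (m + t)                  ≡⟨ ++-‼ʳ u v t ⟩
      v ‼ t                               ≡⟨ cong (_‼ t) v≡πu ⟩
      map (π ⟨$⟩ʳ_) u ‼ t                 ≡⟨ map-‼ _ u t ⟩
      Maybe.map (π ⟨$⟩ʳ_) (u ‼ t)         ≡⟨ cong (Maybe.map _) (++-‼ˡ u v t<m) ⟨
      Maybe.map (π ⟨$⟩ʳ_) ((u ++ v) ‼ t)  ≡⟨ cong (Maybe.map _) (prefix-‼ (<-≤-trans t<m (m≤m+n m m))) ⟨
      Maybe.map (π ⟨$⟩ʳ_) (w ‼ t)         ∎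
      where open ≡-Reasoning

  ReappearsAt : (Fin σ → Fin σ) → ℕ → ℕ → Set
  ReappearsAt f i k = ∀ t → t < k → w ‼ t ≡ Maybe.map f (w ‼ (i + t))

  reappearance⇒PEquiv : ∀ {f i k} → Injective _≡_ _≡_ f → ReappearsAt f i k →
                        PEquiv (take k (drop i w)) (take k w)
  reappearance⇒PEquiv {f} {i} {k} f-inj reappears = f , take-equation , λ _ _ → f-inj
    where
    take-equation : take k w ≡ map f (take k (drop i w))
    take-equation = begin
      take k w                  ≡⟨ take-cong-‼ k w (map f (drop i w)) pointwise ⟩
      take k (map f (drop i w)) ≡⟨ take-map k (drop i w) ⟩
      map f (take k (drop i w)) ∎
      where
      open ≡-Reasoning
      pointwise : ∀ t → t < k → w ‼ t ≡ map f (drop i w) ‼ t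
      pointwise t t<k = trans (reappears t t<k)
        (sym (trans (map-‼ f (drop i w) t) (cong (Maybe.map f) (drop-‼ i w t))))

  GoodSquare : (Fin σ → Fin σ) → ℕ → Set
  GoodSquare f k = GoodPrefixLength w k × SquarePrefix f k

  good⇒¬reappearance : ∀ {f i k} → GoodPrefixLength w k → 1 ≤ i → i + k ≤ length w →
                       Injective _≡_ _≡_ f → ¬ ReappearsAt f i k
  good⇒¬reappearance (_ , _ , unique) 1≤i fits f-inj = unique _ 1≤i fits ∘ reappearance⇒PEquiv f-inj

  period⇒ReappearsAt : ∀ {p k L} → HasPeriod (w ‼_) p L → p + k ≤ L → ReappearsAt id p k
  period⇒ReappearsAt {p} {k} period p+k≤L t t<k = begin
    w ‼ t                ≡⟨ period t (<-≤-trans (+-monoˡ-< p t<k) (≤-trans (≤-reflexive (+-comm k p)) p+k≤L)) ⟩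
    w ‼ (t + p)          ≡⟨ cong (w ‼_) (+-comm t p) ⟩
    w ‼ (p + t)          ≡⟨ Maybeₚ.map-id (w ‼ (p + t)) ⟨
    Maybe.map id (w ‼ (p + t)) ∎
    where open ≡-Reasoning

  square⇒ReappearsAt : ∀ (π : Permutation′ σ) {k m} → k ≤ m →
                       SquareUnder (w ‼_) (Maybe.map (π ⟨$⟩ʳ_)) m → ReappearsAt (π ⟨$⟩ˡ_) m k
  square⇒ReappearsAt π k≤m square t t<k = begin
    w ‼ t                                              ≡⟨ Maybeₚ.map-id (w ‼ t) ⟨
    Maybe.map id (w ‼ t)                               ≡⟨ Maybeₚ.map-cong (λ _ → inverseˡ π) (w ‼ t) ⟨
    Maybe.map ((π ⟨$⟩ˡ_) ∘ (π ⟨$⟩ʳ_)) (w ‼ t)           ≡⟨ Maybeₚ.map-∘ (w ‼ t) ⟩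
    Maybe.map (π ⟨$⟩ˡ_) (Maybe.map (π ⟨$⟩ʳ_) (w ‼ t))  ≡⟨ cong (Maybe.map _) (square t (<-≤-trans t<k k≤m)) ⟨
    Maybe.map (π ⟨$⟩ˡ_) (w ‼ (_ + t))                  ∎
    where open ≡-Reasoning

  no-three-GoodSquares : (π : Permutation′ σ) → ∀ {ka kb kc} → ka < kb → kb < kc →
                         GoodSquare (π ⟨$⟩ʳ_) ka → GoodSquare (π ⟨$⟩ʳ_) kb →
                         GoodSquare (π ⟨$⟩ʳ_) kc → ⊥
  no-three-GoodSquares π ka<kb kb<kc
                       (good-a , ma , refl , sq-a) (good-b , mb , refl , sq-b) (good-c , mc , refl , sq-c)
    with d , 1≤d , refl ← <⇒positive-difference (double-<⇒< {ma} {mb} ka<kb)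
       | e , 1≤e , refl ← <⇒positive-difference (double-<⇒< {mb} {mc} kb<kc)
       | d + e <? ma
  ... | yes d+e<ma
    with p , 1≤p , p≤d , period ← three-squares⇒period (w ‼_) (Maybeₚ.map-injective (⟨$⟩ʳ-injective π))
                                                        1≤d 1≤e d+e<ma sq-a sq-b sq-c
    = good⇒¬reappearance good-a 1≤p (≤-trans p+2ma≤2mb (proj₁ good-b)) id
        (period⇒ReappearsAt period p+2ma≤2mb)
    where
    p+2ma≤2mb : p + (ma + ma) ≤ (ma + d) + (ma + d)
    p+2ma≤2mb = shift-bound ma p≤d
  ... | no d+e≮ma =
    good⇒¬reappearance good-a 1≤mc (≤-trans (+-monoʳ-≤ mc 2ma≤mc) (proj₁ good-c))
      (⟨$⟩ʳ-injective (flip π)) (square⇒ReappearsAt π 2ma≤mc sq-c)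
    where
    2ma≤mc : ma + ma ≤ mc
    2ma≤mc = ≤-trans (+-monoʳ-≤ ma (≮⇒≥ d+e≮ma)) (≤-reflexive (sym (+-assoc ma d e)))
    1≤mc : 1 ≤ mc
    1≤mc = ≤-trans 1≤d (≤-trans (m≤n+m d ma) (m≤m+n (ma + d) e))

  Annotated : ℕ × InjectiveMap σ → Set
  Annotated (k , f , _) =
    GoodPrefixLength w k × SquarePrefix f k × Σ[ π ∈ Permutation′ σ ] f ≗ (π ⟨$⟩ʳ_)

  annotate : ∀ {ks} → All (GoodPrefixLength w) ks →
             Σ[ ps ∈ List (ℕ × InjectiveMap σ) ] map proj₁ ps ≡ ks × All Annotated ps
  annotate [] = [] , refl , []
  annotate {k ∷ _} (good@(k≤∣w∣ , psquare , _) ∷ goods)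
    with π , square ← psquare⇒SquarePrefix k≤∣w∣ psquare
       | ps , keys , annotated ← annotate goods
    = (k , (π ⟨$⟩ʳ_) , ⟨$⟩ʳ-injective π) ∷ ps , cong (k ∷_) keys ,
      (good , square , π , λ _ → refl) ∷ annotated

  annotated⇒NoThreeShareAMap : ∀ {ps} → All Annotated ps → NoThreeShareAMap ps
  annotated⇒NoThreeShareAMap annotated {y = y} x∈ y∈ z∈ x≢y y≢z x≢z x≗y y≗z
    with good-x , square-x , π , x≗π ← All.lookup annotated x∈
       | good-y , square-y , _ ← All.lookup annotated y∈
       | good-z , square-z , _ ← All.lookup annotated z∈
    = no-distinct-triple (no-three-GoodSquares π) x≢y y≢z x≢z
        (good-x , SquarePrefix-≗ x≗π square-x)
        (good-y , SquarePrefix-≗ y≗π square-y)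
        (good-z , SquarePrefix-≗ (λ i → trans (sym (y≗z i)) (y≗π i)) square-z)
    where
    y≗π : itemMap y ≗ (π ⟨$⟩ʳ_)
    y≗π i = trans (sym (x≗y i)) (x≗π i)

lemma27 : (σ : ℕ) (w : Word σ) (ks : List ℕ) →
          Unique ks → All (GoodPrefixLength w) ks → length ks ≤ 2 * (σ !)
lemma27 σ w ks unique goods with ps , keys , annotated ← annotate w goods = begin
  length ks              ≡⟨ cong length keys ⟨
  length (map proj₁ ps)  ≡⟨ length-map proj₁ ps ⟩
  length ps              ≤⟨ length≤2*n! σ ps distinct (annotated⇒NoThreeShareAMap w annotated) ⟩
  2 * σ !                ∎
  where
  open ≤-Reasoning
  distinct : DistinctKeys ps
  distinct = AllPairs.map⁻ (subst Unique (sym keys) unique)
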